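{- Let $X$ and $Y$ be directed graphs with $|V(X)|=|V(Y)|=n$. Then the directed graph $\mathrm{DFS}(X,Y)$ is isomorphic to the directed graph $\mathrm{DFS}(Y,X)$.
   Context: For directed graphs $X,Y$ with the same number $n$ of vertices, the directed friends-and-seats graph $\mathrm{DFS}(X,Y)$ is the directed graph whose vertex set is the set of all bijections $\sigma:V(X)\to V(Y)$, with a directed edge from $\sigma$ to $\phi$ if and only if there exist distinct vertices $a,b\in V(X)$ such that $a\to b$ is an edge of $X$, $\sigma(a)\to\sigma(b)$ is an edge of $Y$, and $\phi=\sigma\circ(a\;b)$, i.e. $\phi(a)=\sigma(b)$, $\phi(b)=\sigma(a)$ and $\phi(c)=\sigma(c)$ for all other $c\in V(X)$. (So $\mathrm{DFS}(Y,X)$ has as vertices the bijections $V(Y)\to V(X)$.) -}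

module Defs where

open import Level using (Level; _⊔_; suc)
open import Data.Nat using (ℕ)
open import Data.Fin using (Fin)
open import Data.Fin.Permutation using (Permutation; _⟨$⟩ʳ_)
open import Data.Product using (Σ; _×_; ∃-syntax)
open import Relation.Binary.PropositionalEquality using (_≡_)
open import Relation.Nullary using (¬_)

record Digraph (n : ℕ) : Set₁ where
  field
    Edge : Fin n → Fin n → Set

open Digraph public

-- A bijection V(X) → V(Y) (both Fin n).
Bij : ℕ → Set
Bij n = Permutation n n

_≈ᵇ_ : ∀ {n} → Bij n → Bij n → Set
_≈ᵇ_ {n} σ φ = ∀ (c : Fin n) → σ ⟨$⟩ʳ c ≡ φ ⟨$⟩ʳ c

-- Edge relation of DFS(X,Y): σ → φ iff there are distinct a b with a → b in X,
-- σ(a) → σ(b) in Y, and φ = σ ∘ (a b), spelled out pointwise.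
DFSEdge : ∀ {n} → Digraph n → Digraph n → Bij n → Bij n → Set
DFSEdge {n} X Y σ φ =
  ∃[ a ] ∃[ b ]
    ( ¬ (a ≡ b)
    × Edge X a b
    × Edge Y (σ ⟨$⟩ʳ a) (σ ⟨$⟩ʳ b)
    × (φ ⟨$⟩ʳ a ≡ σ ⟨$⟩ʳ b)
    × (φ ⟨$⟩ʳ b ≡ σ ⟨$⟩ʳ a)
    × (∀ c → ¬ (c ≡ a) → ¬ (c ≡ b) → φ ⟨$⟩ʳ c ≡ σ ⟨$⟩ʳ c) )

-- Isomorphism of the directed graphs DFS(X,Y) and DFS(Y,X): a bijection F of
-- vertex sets (bijections considered up to pointwise equality) with inverse G,
-- such that σ → φ iff F σ → F φ.
DFSIso : ∀ {n} → Digraph n → Digraph n → Set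
DFSIso {n} X Y =
  Σ (Bij n → Bij n) λ F →
  Σ (Bij n → Bij n) λ G →
    (∀ σ τ → σ ≈ᵇ τ → F σ ≈ᵇ F τ)
  × (∀ σ τ → σ ≈ᵇ τ → G σ ≈ᵇ G τ)
  × (∀ σ → G (F σ) ≈ᵇ σ)
  × (∀ τ → F (G τ) ≈ᵇ τ)
  × (∀ σ φ → DFSEdge X Y σ φ → DFSEdge Y X (F σ) (F φ))
  × (∀ σ φ → DFSEdge Y X (F σ) (F φ) → DFSEdge X Y σ φ)

{-# OPTIONS --safe #-}
module Submission where

open import Defs
open import Data.Nat using (ℕ)
open import Data.Fin using (Fin)
open import Data.Fin.Permutation using (_⟨$⟩ʳ_; _⟨$⟩ˡ_; flip; inverseˡ; inverseʳ)
open import Data.Product using (_×_; _,_)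
open import Function.Bundles using (module Inverse)
open import Relation.Binary.PropositionalEquality using (_≡_; refl; sym; trans; cong; subst₂)
open import Relation.Nullary using (¬_)

-- Inversion σ ↦ σ⁻¹ is the isomorphism. If φ = σ ∘ (a b) then
-- φ⁻¹ = (a b) ∘ σ⁻¹ = σ⁻¹ ∘ (σa σb), and the two edge conditions
-- "a → b in X" and "σa → σb in Y" of the step σ → φ are exactly the edge
-- conditions "σa → σb in Y" and "σ⁻¹(σa) → σ⁻¹(σb) in X" of the step
-- σ⁻¹ → φ⁻¹ in DFS(Y,X). Inversion is an involution, so the converse
-- implication is the same lemma with X and Y exchanged.

private
  variable
    n : ℕ

TransposedAt : Bij n → Fin n → Fin n → Bij n → Set
TransposedAt {n} σ a b φ =
    (φ ⟨$⟩ʳ a ≡ σ ⟨$⟩ʳ b)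
  × (φ ⟨$⟩ʳ b ≡ σ ⟨$⟩ʳ a)
  × (∀ c → ¬ (c ≡ a) → ¬ (c ≡ b) → φ ⟨$⟩ʳ c ≡ σ ⟨$⟩ʳ c)

⟨$⟩ʳ-injective : ∀ (σ : Bij n) {x y} → σ ⟨$⟩ʳ x ≡ σ ⟨$⟩ʳ y → x ≡ y
⟨$⟩ʳ-injective σ e = trans (sym (inverseˡ σ)) (Inverse.inverseʳ σ e)

⟨$⟩ˡ-≡ : ∀ (σ : Bij n) {x y} → σ ⟨$⟩ʳ x ≡ y → σ ⟨$⟩ˡ y ≡ x
⟨$⟩ˡ-≡ σ e = Inverse.inverseʳ σ (sym e)

flip-resp-≈ᵇ : ∀ (σ τ : Bij n) → σ ≈ᵇ τ → flip σ ≈ᵇ flip τ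
flip-resp-≈ᵇ σ τ σ≈τ c =
  sym (⟨$⟩ˡ-≡ τ (trans (sym (σ≈τ (σ ⟨$⟩ˡ c))) (inverseʳ σ)))

flip-TransposedAt : ∀ (σ φ : Bij n) {a b} → TransposedAt σ a b φ →
                    TransposedAt (flip σ) (σ ⟨$⟩ʳ a) (σ ⟨$⟩ʳ b) (flip φ)
flip-TransposedAt σ φ {a} {b} (φa≡σb , φb≡σa , φ≡σ-elsewhere) =
    trans (⟨$⟩ˡ-≡ φ φb≡σa) (sym (inverseˡ σ))
  , trans (⟨$⟩ˡ-≡ φ φa≡σb) (sym (inverseˡ σ))
  , flip-agrees
  where
  flip-agrees : ∀ c → ¬ (c ≡ σ ⟨$⟩ʳ a) → ¬ (c ≡ σ ⟨$⟩ʳ b) → φ ⟨$⟩ˡ c ≡ σ ⟨$⟩ˡ c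
  flip-agrees c c≢σa c≢σb = sym (⟨$⟩ˡ-≡ σ (trans (sym (φ≡σ-elsewhere d d≢a d≢b)) (inverseʳ φ)))
    where
    d : Fin _
    d = φ ⟨$⟩ˡ c
    d≢a : ¬ (d ≡ a)
    d≢a d≡a = c≢σb (trans (sym (inverseʳ φ)) (trans (cong (φ ⟨$⟩ʳ_) d≡a) φa≡σb))
    d≢b : ¬ (d ≡ b)
    d≢b d≡b = c≢σa (trans (sym (inverseʳ φ)) (trans (cong (φ ⟨$⟩ʳ_) d≡b) φb≡σa))

DFSEdge-flip : ∀ (X Y : Digraph n) (σ φ : Bij n) →
               DFSEdge X Y σ φ → DFSEdge Y X (flip σ) (flip φ)
DFSEdge-flip X Y σ φ (a , b , a≢b , a→b , σa→σb , φ≡σ∘⟨ab⟩) =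
    σ ⟨$⟩ʳ a , σ ⟨$⟩ʳ b
  , (λ σa≡σb → a≢b (⟨$⟩ʳ-injective σ σa≡σb))
  , σa→σb
  , subst₂ (Edge X) (sym (inverseˡ σ)) (sym (inverseˡ σ)) a→b
  , flip-TransposedAt σ φ φ≡σ∘⟨ab⟩

theorem3p1 : (n : ℕ) (X Y : Digraph n) → DFSIso X Y
theorem3p1 n X Y =
  -- flip (flip σ) is σ definitionally, by η for the Inverse record.
    flip , flip
  , flip-resp-≈ᵇ , flip-resp-≈ᵇ
  , (λ σ c → refl) , (λ τ c → refl)
  , DFSEdge-flip X Y
  , (λ σ φ → DFSEdge-flip Y X (flip σ) (flip φ))
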